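{- Let $k \ge 4$ be an integer. Then for every integer $r$ with $k < r \le 2k-3$ and every integer $n > r$, there exists a primitive uniquely $K_r^{(k)}$-saturated $k$-uniform hypergraph on $n$ vertices.
   Context: $K_r^{(k)}$ denotes the complete $k$-uniform hypergraph on $r$ vertices. A $k$-uniform hypergraph $H$ is uniquely $K_r^{(k)}$-saturated if $H$ contains no copy of $K_r^{(k)}$ (i.e., no $r$-set of vertices all of whose $k$-subsets are edges), and for every $k$-subset $S$ of $V(H)$ that is not an edge of $H$, the hypergraph $H+S$ contains exactly one copy of $K_r^{(k)}$. A vertex $v$ is dominating in $H$ if every $k$-subset of $V(H)$ containing $v$ is an edge of $H$. $H$ is primitive uniquely $K_r^{(k)}$-saturated if it is uniquely $K_r^{(k)}$-saturated and has no dominating vertex. -}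

module Defs where

open import Data.Nat using (ℕ)
open import Data.Fin using (Fin)
open import Data.Fin.Subset using (Subset; _⊆_; _∈_; ∣_∣)
open import Data.Product using (Σ; _×_)
open import Data.Sum using (_⊎_)
open import Data.Empty using (⊥)
open import Relation.Nullary using (¬_)
open import Relation.Binary.PropositionalEquality using (_≡_)
open import Level using (0ℓ) renaming (suc to lsuc)

record Hypergraph (k n : ℕ) : Set₁ where
  field
    Edge    : Subset n → Set
    uniform : ∀ S → Edge S → ∣ S ∣ ≡ k
open Hypergraph public

AddEdge : ∀ {k n} → Hypergraph k n → Subset n → Subset n → Set
AddEdge H S T = Edge H T ⊎ T ≡ S

IsCopy : ∀ {n} (k r : ℕ) → (Subset n → Set) → Subset n → Set
IsCopy k r E T = (∣ T ∣ ≡ r) × (∀ S → S ⊆ T → ∣ S ∣ ≡ k → E S)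

ExactlyOneCopy : ∀ {n} (k r : ℕ) → (Subset n → Set) → Set
ExactlyOneCopy k r E = Σ _ λ T → IsCopy k r E T × (∀ T' → IsCopy k r E T' → T' ≡ T)

UniquelySaturated : ∀ {k n} → ℕ → Hypergraph k n → Set
UniquelySaturated {k} r H =
  (∀ T → ¬ IsCopy k r (Edge H) T)
  × (∀ S → ∣ S ∣ ≡ k → ¬ Edge H S → ExactlyOneCopy k r (AddEdge H S))

Dominating : ∀ {k n} → Hypergraph k n → Fin n → Set
Dominating {k} H v = ∀ S → v ∈ S → ∣ S ∣ ≡ k → Edge H S

PrimitiveUniquelySaturated : ∀ {k n} → ℕ → Hypergraph k n → Set
PrimitiveUniquelySaturated r H = UniquelySaturated r H × (∀ v → ¬ Dominating H v)

module Submission where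

-- Write r = k + t and k = t + 2 + c (so c ≥ 1 by r ≤ 2k - 3) and n = 2t + 2 + a
-- (so a > c by n > r).  The vertices form blocks P, L, B, A of sizes t, 2, t, a,
-- and a k-set is a non-edge ("bad") iff it is anchored, P ∪ L ∪ J with J ⊆ A,
-- or detached, disjoint from P and not containing all of L.
-- After some facts about finite subsets (notably the exchange lemmas rigid and
-- pairRigid), module Complement gives a general criterion: if every r-set
-- contains a bad k-set and every bad k-set S has a unique "isolator" (an r-set
-- containing S in which S is the only bad k-subset), then the hypergraph of good
-- k-sets is uniquely saturated, and a vertex lying in a bad k-set is not
-- dominating.  Module Construction checks these conditions; the isolator of
-- P ∪ L ∪ J is P ∪ L ∪ B ∪ J, that of a detached set S is P ∪ S.

open import Defs
open import Data.Nat using (ℕ; _≤_; _<_; _*_; _∸_)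
open import Data.Product using (Σ)

open import Data.Nat using (zero; suc; _+_; z≤n; s≤s; s≤s⁻¹; z<s; _≤?_)
open import Data.Nat.Properties hiding (_≟_)
open import Data.Nat.Tactic.RingSolver using (solve-∀)
import Data.Bool as Bool
open import Data.Fin using (Fin; zero; suc; _↑ˡ_; _↑ʳ_; splitAt)
open import Data.Fin.Properties using (splitAt⁻¹-↑ˡ; splitAt⁻¹-↑ʳ)
open import Data.Fin.Subset using (Subset; _⊆_; _∈_; ∣_∣; ⊤; ⊥; ⁅_⁆; inside; outside)
open import Data.Fin.Subset.Properties
open import Data.Vec using ([]; _∷_; _++_; here; there)
import Data.Vec as Vec
open import Data.Vec.Properties using (≡-dec; ++-injectiveˡ; ++-injectiveʳ; ++-injective; lookup-++ˡ; lookup-++ʳ; []=⇒lookup; lookup⇒[]=)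
open import Data.Product using (_×_; _,_; proj₁; proj₂; ∃)
open import Data.Sum using (_⊎_; inj₁; inj₂)
open import Data.Empty using (⊥-elim)
open import Relation.Nullary using (¬_; Dec; yes; no; contradiction)
open import Relation.Nullary.Decidable using (_⊎-dec_; decidable-stable)
open import Relation.Unary using (Decidable)
open import Relation.Binary.Definitions using (DecidableEquality)
open import Relation.Binary.PropositionalEquality

_≟_ : ∀ {n} → DecidableEquality (Subset n)
_≟_ = ≡-dec Bool._≟_

inside⊈outside : ∀ {n} {p q : Subset n} → ¬ (inside ∷ p ⊆ outside ∷ q)
inside⊈outside p⊆q with p⊆q here
... | ()

∣p++q∣ : ∀ {m n} (p : Subset m) (q : Subset n) → ∣ p ++ q ∣ ≡ ∣ p ∣ + ∣ q ∣
∣p++q∣ [] q = refl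
∣p++q∣ (inside ∷ p) q = cong suc (∣p++q∣ p q)
∣p++q∣ (outside ∷ p) q = ∣p++q∣ p q

∣p++q++s∣ : ∀ {m n o} (p : Subset m) (q : Subset n) (s : Subset o) → ∣ p ++ q ++ s ∣ ≡ ∣ p ∣ + (∣ q ∣ + ∣ s ∣)
∣p++q++s∣ p q s = trans (∣p++q∣ p (q ++ s)) (cong (∣ p ∣ +_) (∣p++q∣ q s))

++-⊆ : ∀ {m n} {p p' : Subset m} {q q' : Subset n} → p ⊆ p' → q ⊆ q' → p ++ q ⊆ p' ++ q'
++-⊆ {p = []} {[]} _ q⊆q' = q⊆q'
++-⊆ {p = inside ∷ p} {inside ∷ p'} p⊆p' q⊆q' = in⊆in (++-⊆ (drop-∷-⊆ p⊆p') q⊆q')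
++-⊆ {p = inside ∷ p} {outside ∷ p'} p⊆p' _ = ⊥-elim (inside⊈outside p⊆p')
++-⊆ {p = outside ∷ p} {_ ∷ p'} p⊆p' q⊆q' = out⊆ (++-⊆ (drop-∷-⊆ p⊆p') q⊆q')

++-⊆⁻ : ∀ {m n} (p p' : Subset m) {q q' : Subset n} → p ++ q ⊆ p' ++ q' → p ⊆ p' × q ⊆ q'
++-⊆⁻ [] [] pq⊆ = ⊆-refl , pq⊆
++-⊆⁻ (inside ∷ p) (inside ∷ p') pq⊆ = let p⊆p' , q⊆q' = ++-⊆⁻ p p' (drop-∷-⊆ pq⊆) in in⊆in p⊆p' , q⊆q'
++-⊆⁻ (inside ∷ p) (outside ∷ p') pq⊆ = ⊥-elim (inside⊈outside pq⊆)
++-⊆⁻ (outside ∷ p) (_ ∷ p') pq⊆ = let p⊆p' , q⊆q' = ++-⊆⁻ p p' (drop-∷-⊆ pq⊆) in out⊆ p⊆p' , q⊆q'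

⊆∧∣≥∣⇒≡ : ∀ {n} {p q : Subset n} → p ⊆ q → ∣ q ∣ ≤ ∣ p ∣ → p ≡ q
⊆∧∣≥∣⇒≡ {p = []} {[]} _ _ = refl
⊆∧∣≥∣⇒≡ {p = inside ∷ p} {inside ∷ q} p⊆q q≤p = cong (inside ∷_) (⊆∧∣≥∣⇒≡ (drop-∷-⊆ p⊆q) (s≤s⁻¹ q≤p))
⊆∧∣≥∣⇒≡ {p = outside ∷ p} {outside ∷ q} p⊆q q≤p = cong (outside ∷_) (⊆∧∣≥∣⇒≡ (drop-∷-⊆ p⊆q) q≤p)
⊆∧∣≥∣⇒≡ {p = inside ∷ p} {outside ∷ q} p⊆q _ = ⊥-elim (inside⊈outside p⊆q)
⊆∧∣≥∣⇒≡ {p = outside ∷ p} {inside ∷ q} p⊆q q≤p =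
  contradiction q≤p (<⇒≱ (s≤s (p⊆q⇒∣p∣≤∣q∣ (drop-∷-⊆ p⊆q))))

≢⊤⇒∣p∣<n : ∀ {n} {p : Subset n} → p ≢ ⊤ → ∣ p ∣ < n
≢⊤⇒∣p∣<n {p = p} p≢⊤ = ≤∧≢⇒< (∣p∣≤n p) (λ ∣p∣≡n → p≢⊤ (∣p∣≡n⇒p≡⊤ ∣p∣≡n))

choose : ∀ {n} (q : Subset n) j → j ≤ ∣ q ∣ → Σ (Subset n) λ p → p ⊆ q × ∣ p ∣ ≡ j
choose {n} q zero _ = ⊥ , ⊆-min q , ∣⊥∣≡0 n
choose (outside ∷ q) (suc j) j≤q = let p , p⊆q , ∣p∣ = choose q (suc j) j≤q in outside ∷ p , out⊆ p⊆q , ∣p∣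
choose (inside ∷ q) (suc j) j≤q = let p , p⊆q , ∣p∣ = choose q j (s≤s⁻¹ j≤q) in inside ∷ p , in⊆in p⊆q , cong suc ∣p∣

containing : ∀ {n} (v : Fin n) j → 0 < j → j ≤ n → Σ (Subset n) λ w → v ∈ w × ∣ w ∣ ≡ j
containing zero (suc j) _ (s≤s j≤n) =
  let w , _ , ∣w∣ = choose ⊤ j (≤-trans j≤n (≤-reflexive (sym (∣⊤∣≡n _)))) in inside ∷ w , here , cong suc ∣w∣
containing (suc v) 1 _ _ = ⁅ suc v ⁆ , x∈⁅x⁆ (suc v) , ∣⁅x⁆∣≡1 (suc v)
containing (suc v) (suc (suc j)) _ (s≤s j≤n) =
  let w , v∈w , ∣w∣ = containing v (suc j) z<s j≤n in inside ∷ w , there v∈w , cong suc ∣w∣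

-- Exchange lemma: if X is a nonempty subset of Y and no other subset of Y
-- has the size of X, then X = Y (otherwise swap a vertex of X for one of Y).
rigid : ∀ {n} {X Y : Subset n} → X ⊆ Y → 0 < ∣ X ∣ →
        (∀ X' → X' ⊆ Y → ∣ X' ∣ ≡ ∣ X ∣ → X' ≡ X) → X ≡ Y
rigid {X = []} {[]} _ _ _ = refl
rigid {X = inside ∷ X} {outside ∷ Y} X⊆Y _ _ = ⊥-elim (inside⊈outside X⊆Y)
rigid {X = outside ∷ X} {outside ∷ Y} X⊆Y 0<∣X∣ only =
  cong (outside ∷_) (rigid (drop-∷-⊆ X⊆Y) 0<∣X∣ λ X' X'⊆Y ∣X'∣ →
    cong Vec.tail (only (outside ∷ X') (out⊆ X'⊆Y) ∣X'∣))
rigid {X = outside ∷ X} {inside ∷ Y} X⊆Y 0<∣X∣ only =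
  let Z , Z⊆X , ∣Z∣ = choose X (∣ X ∣ ∸ 1) (m∸n≤m _ 1)
  in contradiction (only (inside ∷ Z) (in⊆in (⊆-trans Z⊆X (drop-∷-⊆ X⊆Y))) (trans (cong suc ∣Z∣) (m+[n∸m]≡n 0<∣X∣)))
                   λ ()
rigid {X = inside ∷ X} {inside ∷ Y} X⊆Y _ only with ∣ Y ∣ ≤? ∣ X ∣
... | yes Y≤X = cong (inside ∷_) (⊆∧∣≥∣⇒≡ (drop-∷-⊆ X⊆Y) Y≤X)
... | no Y≰X = let Z , Z⊆Y , ∣Z∣ = choose Y (suc ∣ X ∣) (≰⇒> Y≰X)
               in contradiction (only (outside ∷ Z) (out⊆ Z⊆Y) ∣Z∣) λ ()

pairRigid : ∀ {l l' : Subset 2} → l ⊆ l' → l ≢ ⊤ →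
            (∀ l* → l* ⊆ l' → l* ≢ ⊤ → ∣ l ∣ ≤ ∣ l* ∣ → l* ≡ l) → l ≡ l'
pairRigid {inside ∷ inside ∷ []} _ l≢⊤ _ = ⊥-elim (l≢⊤ refl)
pairRigid {outside ∷ outside ∷ []} {outside ∷ outside ∷ []} _ _ _ = refl
pairRigid {outside ∷ outside ∷ []} {inside ∷ outside ∷ []} _ _ only = contradiction (only _ ⊆-refl (λ ()) z≤n) λ ()
pairRigid {outside ∷ outside ∷ []} {outside ∷ inside ∷ []} _ _ only = contradiction (only _ ⊆-refl (λ ()) z≤n) λ ()
pairRigid {outside ∷ outside ∷ []} {inside ∷ inside ∷ []} _ _ only =
  contradiction (only (inside ∷ outside ∷ []) ⊆⊤ (λ ()) z≤n) λ ()
pairRigid {inside ∷ outside ∷ []} {inside ∷ outside ∷ []} _ _ _ = refl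
pairRigid {inside ∷ outside ∷ []} {inside ∷ inside ∷ []} _ _ only =
  contradiction (only (outside ∷ inside ∷ []) ⊆⊤ (λ ()) ≤-refl) λ ()
pairRigid {inside ∷ outside ∷ []} {outside ∷ _ ∷ []} l⊆l' _ _ = ⊥-elim (inside⊈outside l⊆l')
pairRigid {outside ∷ inside ∷ []} {outside ∷ inside ∷ []} _ _ _ = refl
pairRigid {outside ∷ inside ∷ []} {inside ∷ inside ∷ []} _ _ only =
  contradiction (only (inside ∷ outside ∷ []) ⊆⊤ (λ ()) ≤-refl) λ ()
pairRigid {outside ∷ inside ∷ []} {_ ∷ outside ∷ []} l⊆l' _ _ = ⊥-elim (inside⊈outside (drop-∷-⊆ l⊆l'))

vertexSplit : ∀ m {n} (v : Fin (m + n)) → (∃ λ i → v ≡ i ↑ˡ n) ⊎ (∃ λ j → v ≡ m ↑ʳ j)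
vertexSplit m v with splitAt m v in eq
... | inj₁ i = inj₁ (i , sym (splitAt⁻¹-↑ˡ eq))
... | inj₂ j = inj₂ (j , sym (splitAt⁻¹-↑ʳ eq))

∈-++⁺ˡ : ∀ {m n} {p : Subset m} (q : Subset n) {i} → i ∈ p → (i ↑ˡ n) ∈ p ++ q
∈-++⁺ˡ {p = p} q {i} i∈p = lookup⇒[]= _ (p ++ q) (trans (lookup-++ˡ p q i) ([]=⇒lookup i∈p))

∈-++⁺ʳ : ∀ {m n} (p : Subset m) {q : Subset n} {j} → j ∈ q → (m ↑ʳ j) ∈ p ++ q
∈-++⁺ʳ p {q} {j} j∈q = lookup⇒[]= _ (p ++ q) (trans (lookup-++ʳ p q j) ([]=⇒lookup j∈q))

module Complement {n : ℕ} (k r : ℕ) (Bad : Subset n → Set) (bad? : Decidable Bad) where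

  H : Hypergraph k n
  H = record { Edge = λ S → ∣ S ∣ ≡ k × ¬ Bad S ; uniform = λ _ → proj₁ }

  Isolates : Subset n → Subset n → Set
  Isolates S T = ∣ T ∣ ≡ r × (∀ S' → S' ⊆ T → ∣ S' ∣ ≡ k → Bad S' → S' ≡ S)

  Hitting : Set
  Hitting = ∀ T → ∣ T ∣ ≡ r → Σ (Subset n) λ S → S ⊆ T × ∣ S ∣ ≡ k × Bad S

  UniqueIsolator : Subset n → Set
  UniqueIsolator S = Σ (Subset n) λ T → Isolates S T × (∀ T' → S ⊆ T' → Isolates S T' → T' ≡ T)

  nonEdge⇒bad : ∀ S → ∣ S ∣ ≡ k → ¬ Edge H S → Bad S
  nonEdge⇒bad S ∣S∣ nonEdge = decidable-stable (bad? S) λ ¬bad → nonEdge (∣S∣ , ¬bad)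

  copy⇒isolates : ∀ {S T} → IsCopy k r (AddEdge H S) T → Isolates S T
  copy⇒isolates {S} {T} (∣T∣ , complete) = ∣T∣ , only
    where
    only : ∀ S' → S' ⊆ T → ∣ S' ∣ ≡ k → Bad S' → S' ≡ S
    only S' S'⊆T ∣S'∣ bad with complete S' S'⊆T ∣S'∣
    ... | inj₁ (_ , ¬bad) = contradiction bad ¬bad
    ... | inj₂ S'≡S = S'≡S

  isolates⇒copy : ∀ {S T} → Isolates S T → IsCopy k r (AddEdge H S) T
  isolates⇒copy {S} {T} (∣T∣ , only) = ∣T∣ , complete
    where
    complete : ∀ S' → S' ⊆ T → ∣ S' ∣ ≡ k → AddEdge H S S'
    complete S' S'⊆T ∣S'∣ with bad? S'
    ... | yes bad = inj₂ (only S' S'⊆T ∣S'∣ bad)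
    ... | no ¬bad = inj₁ (∣S'∣ , ¬bad)

  isolated⊆ : Hitting → ∀ {S T} → Isolates S T → S ⊆ T
  isolated⊆ hit {S} {T} (∣T∣ , only) =
    let S' , S'⊆T , ∣S'∣ , bad = hit T ∣T∣ in subst (_⊆ T) (only S' S'⊆T ∣S'∣ bad) S'⊆T

  uniquelySaturated : Hitting → (∀ S → ∣ S ∣ ≡ k → Bad S → UniqueIsolator S) → UniquelySaturated r H
  uniquelySaturated hit isolator = noCopy , saturated
    where
    noCopy : ∀ T → ¬ IsCopy k r (Edge H) T
    noCopy T (∣T∣ , complete) = let S , S⊆T , ∣S∣ , bad = hit T ∣T∣ in proj₂ (complete S S⊆T ∣S∣) bad

    saturated : ∀ S → ∣ S ∣ ≡ k → ¬ Edge H S → ExactlyOneCopy k r (AddEdge H S)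
    saturated S ∣S∣ nonEdge =
      let T , isolates , unique = isolator S ∣S∣ (nonEdge⇒bad S ∣S∣ nonEdge)
      in T , isolates⇒copy isolates ,
         λ T' copy → unique T' (isolated⊆ hit (copy⇒isolates copy)) (copy⇒isolates copy)

  noDominating : (∀ v → Σ (Subset n) λ S → v ∈ S × ∣ S ∣ ≡ k × Bad S) → ∀ v → ¬ Dominating H v
  noDominating cover v dominating = let S , v∈S , ∣S∣ , bad = cover v in proj₂ (dominating S v∈S ∣S∣) bad

split-≤ : ∀ {a b c d} → a + b ≡ c + d → a ≤ c → d ≤ b
split-≤ {a} {b} {c} {d} eq a≤c = +-cancelˡ-≤ a d b (≤-trans (+-monoˡ-≤ d a≤c) (≤-reflexive (sym eq)))

-- The vertices form four blocks P, L, B, A of sizes t, 2, t,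
-- a; a vertex set is written p ++ l ++ b ++ j with p ⊆ P, l ⊆ L, b ⊆ B, j ⊆ A.
module Construction (t c a : ℕ) (c>0 : 0 < c) (c<a : c < a) where

  k : ℕ
  k = t + (2 + c)

  r : ℕ
  r = t + k

  n : ℕ
  n = t + (2 + (t + a))

  k≡2+t+c : k ≡ 2 + (t + c)
  k≡2+t+c = trans (+-suc t (suc c)) (cong suc (+-suc t c))

  2≤k : 2 ≤ k
  2≤k = ≤-trans (m≤m+n 2 c) (m≤n+m (2 + c) t)

  data Blocks : Subset n → Set where
    blocks : ∀ (p : Subset t) (l : Subset 2) (b : Subset t) (j : Subset a) → Blocks (p ++ l ++ b ++ j)

  blocks? : ∀ S → Blocks S
  blocks? S with Vec.splitAt t S
  ... | p , u , refl with Vec.splitAt 2 u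
  ... | l , v , refl with Vec.splitAt t v
  ... | b , j , refl = blocks p l b j

  anchored : Subset a → Subset n
  anchored J = ⊤ {t} ++ ⊤ {2} ++ ⊥ {t} ++ J

  detached : Subset 2 → Subset (t + a) → Subset n
  detached l w = ⊥ {t} ++ l ++ w

  Anchored : Subset n → Set
  Anchored S = Σ (Subset a) λ J → S ≡ anchored J

  Detached : Subset n → Set
  Detached S = Σ (Subset 2) λ l → Σ (Subset (t + a)) λ w → l ≢ ⊤ × S ≡ detached l w

  Bad : Subset n → Set
  Bad S = Anchored S ⊎ Detached S

  anchored? : ∀ (p : Subset t) (l : Subset 2) (b : Subset t) (j : Subset a) → Dec (Anchored (p ++ l ++ b ++ j))
  anchored? p l b j with p ≟ ⊤ | l ≟ ⊤ | b ≟ ⊥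
  ... | yes refl | yes refl | yes refl = yes (j , refl)
  ... | no p≢⊤ | _ | _ = no λ (_ , eq) → p≢⊤ (++-injectiveˡ p ⊤ eq)
  ... | yes _ | no l≢⊤ | _ = no λ (_ , eq) → l≢⊤ (++-injectiveˡ l ⊤ (++-injectiveʳ p ⊤ eq))
  ... | yes _ | yes _ | no b≢⊥ =
    no λ (_ , eq) → b≢⊥ (++-injectiveˡ b ⊥ (++-injectiveʳ l ⊤ (++-injectiveʳ p ⊤ eq)))

  detached? : ∀ (p : Subset t) (l : Subset 2) (w : Subset (t + a)) → Dec (Detached (p ++ l ++ w))
  detached? p l w with p ≟ ⊥ | l ≟ ⊤
  ... | yes refl | no l≢⊤ = yes (l , w , l≢⊤ , refl)
  ... | no p≢⊥ | _ = no λ (_ , _ , _ , eq) → p≢⊥ (++-injectiveˡ p ⊥ eq)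
  ... | yes _ | yes l≡⊤ =
    no λ (l' , _ , l'≢⊤ , eq) → l'≢⊤ (trans (sym (++-injectiveˡ l l' (++-injectiveʳ p ⊥ eq))) l≡⊤)

  bad? : Decidable Bad
  bad? S with blocks? S
  ... | blocks p l b j = anchored? p l b j ⊎-dec detached? p l (b ++ j)

  open Complement k r Bad bad?

  ∣⊤++∣ : ∀ {m} (q : Subset m) → ∣ ⊤ {t} ++ q ∣ ≡ t + ∣ q ∣
  ∣⊤++∣ q = trans (∣p++q∣ (⊤ {t}) q) (cong (_+ ∣ q ∣) (∣⊤∣≡n t))

  ∣anchored∣ : ∀ J → ∣ anchored J ∣ ≡ t + (2 + ∣ J ∣)
  ∣anchored∣ J = trans (∣⊤++∣ _) (cong (λ x → t + (2 + x)) (trans (∣p++q∣ (⊥ {t}) J) (cong (_+ ∣ J ∣) (∣⊥∣≡0 t))))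

  ∣anchored∣≡k : ∀ {J} → ∣ J ∣ ≡ c → ∣ anchored J ∣ ≡ k
  ∣anchored∣≡k {J} ∣J∣ = trans (∣anchored∣ J) (cong (λ x → t + (2 + x)) ∣J∣)

  ∣anchored∣≡k⇒ : ∀ {J} → ∣ anchored J ∣ ≡ k → ∣ J ∣ ≡ c
  ∣anchored∣≡k⇒ {J} ∣S∣ = +-cancelˡ-≡ 2 _ _ (+-cancelˡ-≡ t _ _ (trans (sym (∣anchored∣ J)) ∣S∣))

  ∣detached∣ : ∀ l w → ∣ detached l w ∣ ≡ ∣ l ∣ + ∣ w ∣
  ∣detached∣ l w = trans (∣p++q∣ (⊥ {t}) (l ++ w)) (trans (cong (_+ ∣ l ++ w ∣) (∣⊥∣≡0 t)) (∣p++q∣ l w))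

  anchored-injective : ∀ {J J'} → anchored J' ≡ anchored J → J' ≡ J
  anchored-injective eq = ++-injectiveʳ (⊥ {t}) ⊥ (++-injectiveʳ (⊤ {2}) ⊤ (++-injectiveʳ (⊤ {t}) ⊤ eq))

  ∣B∪A∣ : ∀ (b : Subset t) (j : Subset a) → ∣ ⊤ {t} ++ ⊤ {2} ++ b ++ j ∣ ≡ r → ∣ b ∣ + ∣ j ∣ ≡ t + c
  ∣B∪A∣ b j ∣T∣ = +-cancelˡ-≡ 2 _ _ (+-cancelˡ-≡ t _ _ (begin
    t + (2 + (∣ b ∣ + ∣ j ∣))    ≡⟨ cong (λ x → t + (2 + x)) (∣p++q∣ b j) ⟨
    t + (2 + ∣ b ++ j ∣)         ≡⟨ ∣⊤++∣ _ ⟨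
    ∣ ⊤ {t} ++ ⊤ {2} ++ b ++ j ∣ ≡⟨ ∣T∣ ⟩
    t + k                      ≡⟨ cong (t +_) k≡2+t+c ⟩
    t + (2 + (t + c))          ∎))
    where open ≡-Reasoning

  -- The isolator of P ∪ L ∪ J is P ∪ L ∪ B ∪ J: a detached subset of it has
  -- fewer than k vertices, and any other isolator could swap a vertex of J
  -- for another vertex of A.
  anchoredIsolator : ∀ J → ∣ J ∣ ≡ c → UniqueIsolator (anchored J)
  anchoredIsolator J ∣J∣ = withB , (∣withB∣ , only) , unique
    where
    withB : Subset n
    withB = ⊤ {t} ++ ⊤ {2} ++ ⊤ {t} ++ J

    ∣withB∣ : ∣ withB ∣ ≡ r
    ∣withB∣ = trans (∣⊤++∣ _) (trans (cong (λ x → t + (2 + x)) (trans (∣⊤++∣ J) (cong (t +_) ∣J∣)))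
                                     (cong (t +_) (sym k≡2+t+c)))

    only : ∀ S' → S' ⊆ withB → ∣ S' ∣ ≡ k → Bad S' → S' ≡ anchored J
    only _ S'⊆ ∣S'∣ (inj₁ (J' , refl)) =
      cong anchored (⊆∧∣≥∣⇒≡ J'⊆J (≤-reflexive (trans ∣J∣ (sym (∣anchored∣≡k⇒ ∣S'∣)))))
      where
      J'⊆J : J' ⊆ J
      J'⊆J = proj₂ (++-⊆⁻ (⊥ {t}) ⊤ (proj₂ (++-⊆⁻ (⊤ {2}) ⊤ (proj₂ (++-⊆⁻ (⊤ {t}) ⊤ S'⊆)))))
    only _ S'⊆ ∣S'∣ (inj₂ (l , w , l≢⊤ , refl)) = contradiction ∣S'∣ (<⇒≢ small)
      where
      w⊆ : w ⊆ ⊤ {t} ++ J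
      w⊆ = proj₂ (++-⊆⁻ l ⊤ (proj₂ (++-⊆⁻ (⊥ {t}) ⊤ S'⊆)))
      small : ∣ detached l w ∣ < k
      small = begin-strict
        ∣ detached l w ∣ ≡⟨ ∣detached∣ l w ⟩
        ∣ l ∣ + ∣ w ∣    <⟨ +-mono-<-≤ (≢⊤⇒∣p∣<n l≢⊤) (p⊆q⇒∣p∣≤∣q∣ w⊆) ⟩
        2 + ∣ ⊤ {t} ++ J ∣ ≡⟨ cong (2 +_) (trans (∣⊤++∣ J) (cong (t +_) ∣J∣)) ⟩
        2 + (t + c)      ≡⟨ k≡2+t+c ⟨
        k                ∎
        where open ≤-Reasoning

    unique : ∀ T' → anchored J ⊆ T' → Isolates (anchored J) T' → T' ≡ withB
    unique T' S⊆T' iso' with blocks? T'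
    ... | blocks p l b j =
      shape (⊆-antisym ⊆⊤ P⊆p) (⊆-antisym ⊆⊤ L⊆l) (rigid J⊆j (subst (0 <_) (sym ∣J∣) c>0) exchange) (proj₁ iso')
      where
      P⊆p : ⊤ ⊆ p
      P⊆p = proj₁ (++-⊆⁻ ⊤ p S⊆T')
      L⊆l : ⊤ ⊆ l
      L⊆l = proj₁ (++-⊆⁻ ⊤ l (proj₂ (++-⊆⁻ ⊤ p S⊆T')))
      J⊆j : J ⊆ j
      J⊆j = proj₂ (++-⊆⁻ ⊥ b (proj₂ (++-⊆⁻ ⊤ l (proj₂ (++-⊆⁻ ⊤ p S⊆T')))))
      -- another c-subset J' of j would make P ∪ L ∪ J' a second bad k-subset
      exchange : ∀ J' → J' ⊆ j → ∣ J' ∣ ≡ ∣ J ∣ → J' ≡ J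
      exchange J' J'⊆j ∣J'∣ = anchored-injective (proj₂ iso' (anchored J')
        (++-⊆ P⊆p (++-⊆ L⊆l (++-⊆ (⊆-min b) J'⊆j))) (∣anchored∣≡k (trans ∣J'∣ ∣J∣)) (inj₁ (J' , refl)))
      shape : ∀ {p' l' j'} → p' ≡ ⊤ → l' ≡ ⊤ → J ≡ j' → ∣ p' ++ l' ++ b ++ j' ∣ ≡ r → p' ++ l' ++ b ++ j' ≡ withB
      shape refl refl refl ∣T'∣ = cong (λ b' → ⊤ {t} ++ ⊤ {2} ++ b' ++ J) (∣p∣≡n⇒p≡⊤ {p = b}
        (+-cancelʳ-≡ c _ _ (trans (cong (∣ b ∣ +_) (sym ∣J∣)) (∣B∪A∣ b J ∣T'∣))))

  -- The isolator of a detached set S is P ∪ S: its only bad k-subset is S,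
  -- and any other isolator could swap vertices of L or of B ∪ A.
  detachedIsolator : ∀ l w → l ≢ ⊤ → ∣ l ∣ + ∣ w ∣ ≡ k → UniqueIsolator (detached l w)
  detachedIsolator l w l≢⊤ ∣lw∣ = withP , (∣withP∣ , only) , unique
    where
    withP : Subset n
    withP = ⊤ {t} ++ l ++ w

    ∣withP∣ : ∣ withP ∣ ≡ r
    ∣withP∣ = trans (∣⊤++∣ (l ++ w)) (cong (t +_) (trans (∣p++q∣ l w) ∣lw∣))

    only : ∀ S' → S' ⊆ withP → ∣ S' ∣ ≡ k → Bad S' → S' ≡ detached l w
    only _ S'⊆ _ (inj₁ (J , refl)) = contradiction (⊆-antisym ⊆⊤ (proj₁ (++-⊆⁻ ⊤ l (proj₂ (++-⊆⁻ ⊤ ⊤ S'⊆))))) l≢⊤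
    only _ S'⊆ ∣S'∣ (inj₂ (l' , w' , _ , refl)) =
      cong (⊥ {t} ++_) (⊆∧∣≥∣⇒≡ (proj₂ (++-⊆⁻ ⊥ ⊤ S'⊆)) (≤-reflexive same-size))
      where
      same-size : ∣ l ++ w ∣ ≡ ∣ l' ++ w' ∣
      same-size = trans (∣p++q∣ l w) (trans ∣lw∣ (trans (sym ∣S'∣) (trans (∣detached∣ l' w') (sym (∣p++q∣ l' w')))))

    0<∣w∣ : 0 < ∣ w ∣
    0<∣w∣ = +-cancelˡ-< (∣ l ∣) 0 (∣ w ∣)
      (subst₂ _<_ (sym (+-identityʳ ∣ l ∣)) (sym ∣lw∣) (<-≤-trans (≢⊤⇒∣p∣<n l≢⊤) 2≤k))

    unique : ∀ T' → detached l w ⊆ T' → Isolates (detached l w) T' → T' ≡ withP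
    unique T' S⊆T' iso' with blocks? T'
    ... | blocks p l' b j = shape (pairRigid l⊆l' l≢⊤ exchangeL) (rigid w⊆bj 0<∣w∣ exchangeW) (proj₁ iso')
      where
      l⊆l' : l ⊆ l'
      l⊆l' = proj₁ (++-⊆⁻ l l' (proj₂ (++-⊆⁻ ⊥ p S⊆T')))
      w⊆bj : w ⊆ b ++ j
      w⊆bj = proj₂ (++-⊆⁻ l l' (proj₂ (++-⊆⁻ ⊥ p S⊆T')))
      exchange : ∀ l* w* → l* ⊆ l' → w* ⊆ b ++ j → l* ≢ ⊤ → ∣ l* ∣ + ∣ w* ∣ ≡ k → l* ≡ l × w* ≡ w
      exchange l* w* l*⊆ w*⊆ l*≢⊤ ∣l*w*∣ = ++-injective l* l (++-injectiveʳ (⊥ {t}) ⊥ (proj₂ iso' (detached l* w*)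
        (++-⊆ (⊆-min p) (++-⊆ l*⊆ w*⊆)) (trans (∣detached∣ l* w*) ∣l*w*∣) (inj₂ (l* , w* , l*≢⊤ , refl))))
      exchangeW : ∀ w* → w* ⊆ b ++ j → ∣ w* ∣ ≡ ∣ w ∣ → w* ≡ w
      exchangeW w* w*⊆ ∣w*∣ = proj₂ (exchange l w* l⊆l' w*⊆ l≢⊤ (trans (cong (∣ l ∣ +_) ∣w*∣) ∣lw∣))
      -- a larger part l* of L is compensated by dropping vertices of w
      exchangeL : ∀ l* → l* ⊆ l' → l* ≢ ⊤ → ∣ l ∣ ≤ ∣ l* ∣ → l* ≡ l
      exchangeL l* l*⊆ l*≢⊤ l≤l* =
        let w* , w*⊆w , ∣w*∣ = choose w (k ∸ ∣ l* ∣) room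
        in proj₁ (exchange l* w* l*⊆ (⊆-trans w*⊆w w⊆bj) l*≢⊤
                   (trans (cong (∣ l* ∣ +_) ∣w*∣) (m+[n∸m]≡n (≤-trans (∣p∣≤n l*) 2≤k))))
        where
        room : k ∸ ∣ l* ∣ ≤ ∣ w ∣
        room = ≤-trans (∸-monoʳ-≤ k l≤l*) (≤-reflexive (trans (cong (_∸ ∣ l ∣) (sym ∣lw∣)) (m+n∸m≡n ∣ l ∣ ∣ w ∣)))
      shape : ∀ {l'' w''} → l ≡ l'' → w ≡ w'' → ∣ p ++ l'' ++ w'' ∣ ≡ r → p ++ l'' ++ w'' ≡ withP
      shape refl refl ∣T'∣ = cong (_++ l ++ w) (∣p∣≡n⇒p≡⊤ {p = p}
        (+-cancelʳ-≡ k _ _ (trans (cong (∣ p ∣ +_) (sym ∣lw∣)) (trans (sym (∣p++q++s∣ p l w)) ∣T'∣))))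

  anchoredWithin : ∀ (j : Subset a) → c ≤ ∣ j ∣ → Σ (Subset a) λ J → J ⊆ j × ∣ anchored J ∣ ≡ k
  anchoredWithin j c≤j = let J , J⊆j , ∣J∣ = choose j c c≤j in J , J⊆j , ∣anchored∣≡k ∣J∣

  detachedInside : ∀ (p : Subset t) (l : Subset 2) (w : Subset (t + a)) l* → l* ⊆ l → l* ≢ ⊤ → k ≤ ∣ l* ∣ + ∣ w ∣ →
                   Σ (Subset n) λ S → S ⊆ p ++ l ++ w × ∣ S ∣ ≡ k × Bad S
  detachedInside p l w l* l*⊆l l*≢⊤ enough =
    let w* , w*⊆w , ∣w*∣ = choose w (k ∸ ∣ l* ∣) (m≤n+o⇒m∸n≤o k ∣ l* ∣ enough)
    in detached l* w* , ++-⊆ (⊆-min p) (++-⊆ l*⊆l w*⊆w) ,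
       trans (∣detached∣ l* w*) (trans (cong (∣ l* ∣ +_) ∣w*∣) (m+[n∸m]≡n (≤-trans (∣p∣≤n l*) 2≤k))) ,
       inj₂ (l* , w* , l*≢⊤ , refl)

  -- Every r-set T contains a bad k-set: an anchored one if T ⊇ P ∪ L, and a
  -- detached one otherwise, since then T has at least k - 1 vertices outside
  -- P and, if it contains all of L, at least k.
  hitting : Hitting
  hitting T ∣T∣ with blocks? T
  ... | blocks p l b j with p ≟ ⊤ | l ≟ ⊤
  ... | yes refl | yes refl =
    let J , J⊆j , ∣S∣ = anchoredWithin j (split-≤ (∣B∪A∣ b j ∣T∣) (∣p∣≤n b))
    in anchored J , ++-⊆ {p = ⊤ {t}} ⊆-refl (++-⊆ {p = ⊤ {2}} ⊆-refl (++-⊆ (⊆-min b) J⊆j)) , ∣S∣ , inj₁ (J , refl)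
  ... | _ | no l≢⊤ =
    detachedInside p l (b ++ j) l ⊆-refl l≢⊤ (split-≤ (trans (sym (∣p++q++s∣ p l (b ++ j))) ∣T∣) (∣p∣≤n p))
  ... | no p≢⊤ | yes refl =
    detachedInside p ⊤ (b ++ j) (inside ∷ outside ∷ []) ⊆⊤ (λ ())
      (split-≤ (trans (sym (+-suc ∣ p ∣ (suc ∣ b ++ j ∣))) (trans (sym (∣p++q++s∣ p (⊤ {2}) (b ++ j))) ∣T∣)) (≢⊤⇒∣p∣<n p≢⊤))

  c≤∣A∣ : c ≤ ∣ ⊤ {a} ∣
  c≤∣A∣ = ≤-trans (<⇒≤ c<a) (≤-reflexive (sym (∣⊤∣≡n a)))

  -- Every vertex lies in a bad k-set: those of P ∪ L in an anchored set, those
  -- of B ∪ A in a detached set meeting L in one vertex (here a > c is used).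
  cover : ∀ v → Σ (Subset n) λ S → v ∈ S × ∣ S ∣ ≡ k × Bad S
  cover v with vertexSplit t v
  ... | inj₁ (i , refl) =
    let J , _ , ∣S∣ = anchoredWithin ⊤ c≤∣A∣ in anchored J , ∈-++⁺ˡ _ ∈⊤ , ∣S∣ , inj₁ (J , refl)
  ... | inj₂ (v' , refl) with vertexSplit 2 v'
  ...   | inj₁ (i , refl) =
    let J , _ , ∣S∣ = anchoredWithin ⊤ c≤∣A∣ in anchored J , ∈-++⁺ʳ (⊤ {t}) (∈-++⁺ˡ _ ∈⊤) , ∣S∣ , inj₁ (J , refl)
  ...   | inj₂ (u , refl) =
    let w , u∈w , ∣w∣ = containing u (suc (t + c)) z<s (≤-trans (≤-reflexive (sym (+-suc t c))) (+-monoʳ-≤ t c<a))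
    in detached (inside ∷ outside ∷ []) w , ∈-++⁺ʳ (⊥ {t}) (∈-++⁺ʳ (inside ∷ outside ∷ []) u∈w) ,
       trans (∣detached∣ _ w) (trans (cong suc ∣w∣) (sym k≡2+t+c)) , inj₂ (_ , w , (λ ()) , refl)

  primitiveSaturated : Σ (Hypergraph k n) (PrimitiveUniquelySaturated r)
  primitiveSaturated = H , uniquelySaturated hitting isolator , noDominating cover
    where
    isolator : ∀ S → ∣ S ∣ ≡ k → Bad S → UniqueIsolator S
    isolator _ ∣S∣ (inj₁ (J , refl)) = anchoredIsolator J (∣anchored∣≡k⇒ ∣S∣)
    isolator _ ∣S∣ (inj₂ (l , w , l≢⊤ , refl)) = detachedIsolator l w l≢⊤ (trans (sym (∣detached∣ l w)) ∣S∣)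

record Parameters (k r n : ℕ) : Set where
  field
    t c a : ℕ
    c>0   : 0 < c
    c<a   : c < a
    k≡    : k ≡ t + (2 + c)
    r≡    : r ≡ t + k
    n≡    : n ≡ t + (2 + (t + a))

-- Write k = 4 + x, r = k + 1 + y and n = r + 1 + w; then r ≤ 2k - 3 gives
-- y ≤ x, say x = y + z, and t = 1 + y, c = 1 + z, a = c + 1 + w will do.
parameters : ∀ {k r n} → 4 ≤ k → k < r → r ≤ 2 * k ∸ 3 → r < n → Parameters k r n
parameters 4≤k k<r r≤2k-3 r<n
  with m≤n⇒∃[o]m+o≡n 4≤k | m≤n⇒∃[o]m+o≡n k<r | m≤n⇒∃[o]m+o≡n r<n
... | x , refl | y , refl | w , refl with m≤n⇒∃[o]m+o≡n (y≤x r≤2k-3)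
  where
  y≤x : suc (4 + x) + y ≤ 2 * (4 + x) ∸ 3 → y ≤ x
  y≤x bound = +-cancelˡ-≤ (5 + x) y x (≤-trans bound (≤-reflexive (cong suc (twice x))))
    where
    twice : ∀ m → m + (4 + m + 0) ≡ 4 + (m + m)
    twice = solve-∀
... | z , refl = record
  { t = suc y ; c = suc z ; a = suc z + suc w
  ; c>0 = z<s ; c<a = m<m+n (suc z) z<s
  ; k≡ = k≡ y z ; r≡ = r≡ y z ; n≡ = n≡ y z w }
  where
  k≡ : ∀ y z → 4 + (y + z) ≡ suc y + (2 + suc z)
  k≡ = solve-∀
  r≡ : ∀ y z → suc (4 + (y + z)) + y ≡ suc y + (4 + (y + z))
  r≡ = solve-∀
  n≡ : ∀ y z w → suc (suc (4 + (y + z)) + y) + w ≡ suc y + (2 + (suc y + (suc z + suc w)))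
  n≡ = solve-∀

theorem2 : (k : ℕ) → 4 ≤ k → (r : ℕ) → k < r → r ≤ 2 * k ∸ 3 → (n : ℕ) → r < n →
    Σ (Hypergraph k n) (λ H → PrimitiveUniquelySaturated r H)
theorem2 k 4≤k r k<r r≤2k-3 n r<n with parameters 4≤k k<r r≤2k-3 r<n
... | record { t = t ; c = c ; a = a ; c>0 = c>0 ; c<a = c<a ; k≡ = refl ; r≡ = refl ; n≡ = refl } =
  Construction.primitiveSaturated t c a c>0 c<a
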